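{- Let $k$ be a positive integer. For positive integers $n$ and integers $\lambda$, let $\rho_{k,\lambda}(n)$ denote the number of $k$-tuples $(x_1,\dots,x_k)\in(\mathbb{Z}/n\mathbb{Z})^k$ with $x_1^2+\cdots+x_k^2\equiv\lambda\pmod n$. Then: \begin{itemize} \item[i)] $\rho_{k,1}(2)=\rho_{k,0}(2)=2^{k-1}$; \item[ii)] $\rho_{k,0}(4)=4^{k-1}+2^{\frac{3k}{2}-1}\cos\left(\frac{k\pi}{4}\right)$; \item[iii)] $\rho_{k,1}(4)=4^{k-1}+2^{\frac{3k}{2}-1}\sin\left(\frac{k\pi}{4}\right)$; \item[iv)] $\rho_{k,2}(4)=4^{k-1}-2^{\frac{3k}{2}-1}\cos\left(\frac{k\pi}{4}\right)$; \item[v)] $\rho_{k,3}(4)=4^{k-1}-2^{\frac{3k}{2}-1}\sin\left(\frac{k\pi}{4}\right)$; \item[vi)] $\rho_{k,0}(8)=8^{k-1}+2^{2k-2}\cos\left(\frac{k\pi}{4}\right)+2^{\frac{5k}{2}-2}\cos\left(\frac{k\pi}{4}\right)+2^{2k-2}\cos\left(\frac{3k\pi}{4}\right)$; \item[vii)] $\rho_{k,1}(8)=2^{2k-3}\left(2^k+2^{\frac{k}{2}+1}\sin\left(\frac{\pi k}{4}\right)+2\sin\left(\frac{\pi(k+1)}{4}\right)-2\cos\left(\frac{3\pi k+\pi}{4}\right)\right)$; \item[viii)] $\rho_{k,2}(8)=8^{k-1}-2^{\frac{5k}{2}-2}\cos\left(\frac{k\pi}{4}\right)+2^{2k-2}\sin\left(\frac{k\pi}{4}\right)-2^{2k-2}\sin\left(\frac{3k\pi}{4}\right)$;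 \item[ix)] $\rho_{k,3}(8)=2^{2k-3}\left(2^k-2^{\frac{k}{2}+1}\sin\left(\frac{\pi k}{4}\right)-2\left(\cos\left(\frac{\pi(k+1)}{4}\right)+\cos\left(\frac{3\pi(k+1)}{4}\right)\right)\right)$; \item[x)] $\rho_{k,4}(8)=8^{k-1}-2^{2k-2}\cos\left(\frac{k\pi}{4}\right)+2^{\frac{5k}{2}-2}\cos\left(\frac{k\pi}{4}\right)-2^{2k-2}\cos\left(\frac{3k\pi}{4}\right)$; \item[xi)] $\rho_{k,5}(8)=2^{2k-3}\left(2^k+2^{\frac{k}{2}+1}\sin\left(\frac{\pi k}{4}\right)-2\sin\left(\frac{\pi(k+1)}{4}\right)+2\cos\left(\frac{3\pi k+\pi}{4}\right)\right)$; \item[xii)] $\rho_{k,6}(8)=8^{k-1}-2^{\frac{5k}{2}-2}\cos\left(\frac{k\pi}{4}\right)-2^{2k-2}\sin\left(\frac{k\pi}{4}\right)+2^{2k-2}\sin\left(\frac{3k\pi}{4}\right)$; \item[xiii)] $\rho_{k,7}(8)=2^{2k-3}\left(2^k-2^{\frac{k}{2}+1}\sin\left(\frac{\pi k}{4}\right)-2\sin\left(\frac{3\pi k+\pi}{4}\right)+2\cos\left(\frac{\pi(k+1)}{4}\right)\right)$. \end{itemize}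
   Context: For positive integers $k,n$ and an integer $\lambda$, $\rho_{k,\lambda}(n)$ is the number of incongruent solutions $(x_1,\dots,x_k)\in(\mathbb{Z}/n\mathbb{Z})^k$ of $x_1^2+\cdots+x_k^2\equiv\lambda\pmod n$. -}

module Defs where

open import Data.Nat as ℕ using (ℕ; zero; suc; NonZero)
open import Data.Nat.DivMod using (_%_)
open import Data.Fin using (Fin; toℕ)
open import Data.Vec using (Vec; []; _∷_)
open import Data.List using (List; []; _∷_; length; filter; map; concatMap)
open import Data.Integer using (+_)
open import Data.Rational as ℚ using (ℚ; 0ℚ; 1ℚ)
open import Data.List using (allFin)


tuples : (n k : ℕ) → List (Vec (Fin n) k)
tuples n zero    = [] ∷ []
tuples n (suc k) =
  concatMap (λ x → map (x ∷_) (tuples n k)) (allFin n)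

sumSq : ∀ {n k} → Vec (Fin n) k → ℕ
sumSq []       = 0
sumSq (x ∷ xs) = toℕ x ℕ.* toℕ x ℕ.+ sumSq xs

rho : (k : ℕ) (lam : ℕ) (n : ℕ) → .{{_ : NonZero n}} → ℕ
rho k lam n = length (filter (λ v → (sumSq v % n) ℕ.≟ (lam % n)) (tuples n k))

-- The field ℚ(√2): a + b√2 with a b : ℚ (representation is unique,
-- since √2 is irrational and ℚ is normalised, so ≡ is the real equality).

record Q2 : Set where
  constructor q2
  field
    re : ℚ
    ir : ℚ

infixl 6 _⊕_ _⊖_
infixl 7 _⊗_
infixr 8 _^_

_⊕_ : Q2 → Q2 → Q2
q2 a b ⊕ q2 c d = q2 (a ℚ.+ c) (b ℚ.+ d)

neg : Q2 → Q2
neg (q2 a b) = q2 (ℚ.- a) (ℚ.- b)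

_⊖_ : Q2 → Q2 → Q2
x ⊖ y = x ⊕ neg y

_⊗_ : Q2 → Q2 → Q2
q2 a b ⊗ q2 c d =
  q2 (a ℚ.* c ℚ.+ (+ 2 ℚ./ 1) ℚ.* (b ℚ.* d)) (a ℚ.* d ℚ.+ b ℚ.* c)

cst : ℚ → Q2
cst a = q2 a 0ℚ

nat : ℕ → Q2
nat m = cst (+ m ℚ./ 1)

√2 : Q2
√2 = q2 0ℚ 1ℚ

_^_ : Q2 → ℕ → Q2
x ^ zero  = cst 1ℚ
x ^ suc m = x ⊗ (x ^ m)

h√2 : Q2
h√2 = q2 0ℚ ℚ.½

cosπ/4 : ℕ → Q2
cosπ/4 0 = cst 1ℚ
cosπ/4 1 = h√2
cosπ/4 2 = cst 0ℚ
cosπ/4 3 = neg h√2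
cosπ/4 4 = cst (ℚ.- 1ℚ)
cosπ/4 5 = neg h√2
cosπ/4 6 = cst 0ℚ
cosπ/4 7 = h√2
cosπ/4 (suc (suc (suc (suc (suc (suc (suc (suc m)))))))) = cosπ/4 m

sinπ/4 : ℕ → Q2
sinπ/4 0 = cst 0ℚ
sinπ/4 1 = h√2
sinπ/4 2 = cst 1ℚ
sinπ/4 3 = h√2
sinπ/4 4 = cst 0ℚ
sinπ/4 5 = neg h√2
sinπ/4 6 = cst (ℚ.- 1ℚ)
sinπ/4 7 = neg h√2
sinπ/4 (suc (suc (suc (suc (suc (suc (suc (suc m)))))))) = sinπ/4 m

{-# OPTIONS --safe #-}
-- Splitting off the first coordinate of a tuple gives the recurrence
-- ρ_{k+1,λ}(n) = Σ_{x mod n} ρ_{k,λ-x²}(n).  For n = 2, 4, 8 the claimed closed forms obey it too: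
-- they are polynomials over ℚ(√2) in √2^k and in the cosines and sines of kπ/4 and 3kπ/4, the
-- step k ↦ k + 1 multiplies √2^k by √2 and rotates both angles, and the recurrence becomes a
-- polynomial identity, checked by the ring solver.  Both sides agree at k = 1.
module Submission where

open import Defs
open import Data.Nat using (ℕ; _≤_; _+_; _*_)
open import Data.Integer using (+_)
open import Data.Rational using (_/_)
open import Data.Product using (_×_)
open import Relation.Binary.PropositionalEquality using (_≡_)

open import Algebra.Bundles using (CommutativeRing; RawRing)
open import Algebra.Structures {A = Q2} _≡_ using (IsCommutativeRing)
import Algebra.Solver.Ring.AlmostCommutativeRing as AlmostCommutativeRing
import Algebra.Solver.Ring.Simple as RingSolver
open import Data.Bool using (true; false)
open import Data.Fin using (Fin; toℕ; #_)
open import Data.Integer as ℤ using ()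
import Data.Integer.Properties as ℤₚ
open import Data.List using (List; []; _∷_; _++_; length; filter; map; concatMap; foldr; allFin)
open import Data.List.Properties using (filter-++; filter-≐; length-++; map-cong)
open import Data.Nat as ℕ using (zero; suc; _∸_; NonZero)
open import Data.Nat.Coprimality using (Coprime; 1-coprimeTo) renaming (sym to coprime-sym)
open import Data.Nat.DivMod using (_%_; %-distribˡ-+; m%n%n≡m%n; n%n≡0; m%n≤n; %-remove-+ˡ)
open import Data.Nat.Divisibility using (_∣_; m%n≡0⇒n∣m)
open import Data.Nat.ListAction using (sum)
import Data.Nat.Properties as ℕₚ
open import Algebra.Properties.CommutativeSemigroup ℕₚ.+-commutativeSemigroup
  using (xy∙z≈xz∙y; xy∙z≈zy∙x)
open import Data.Product using (_,_)
open import Data.Rational as ℚ using (ℚ; 0ℚ; 1ℚ; mkℚ)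
import Data.Rational.Properties as ℚₚ
open import Data.Rational.Solver using (module +-*-Solver)
open import Data.Vec as Vec using (Vec)
open import Function using (_∘_)
open import Level using (0ℓ)
open import Relation.Binary.Definitions using (DecidableEquality)
open import Relation.Binary.PropositionalEquality
  using (refl; sym; trans; cong; cong₂; isEquivalence; module ≡-Reasoning)
open import Relation.Nullary using (yes; no; does)
open import Relation.Unary using (Pred; Decidable)

module _ {a p} {A : Set a} {P : Pred A p} (P? : Decidable P) where

  length-filter-++ : ∀ xs ys →
    length (filter P? (xs ++ ys)) ≡ length (filter P? xs) + length (filter P? ys)
  length-filter-++ xs ys = trans (cong length (filter-++ P? xs ys)) (length-++ (filter P? xs))

  length-filter-concatMap : ∀ {b} {B : Set b} (f : B → List A) xs →
    length (filter P? (concatMap f xs)) ≡ sum (map (λ x → length (filter P? (f x))) xs)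
  length-filter-concatMap f []       = refl
  length-filter-concatMap f (x ∷ xs) = trans (length-filter-++ (f x) (concatMap f xs))
    (cong (_+_ (length (filter P? (f x)))) (length-filter-concatMap f xs))

  length-filter-map : ∀ {b} {B : Set b} (f : B → A) xs →
    length (filter P? (map f xs)) ≡ length (filter (P? ∘ f) xs)
  length-filter-map f [] = refl
  length-filter-map f (x ∷ xs) with does (P? (f x))
  ... | true  = cong suc (length-filter-map f xs)
  ... | false = length-filter-map f xs

-- negMod m d represents -m modulo d, avoiding truncated subtraction.
negMod : ℕ → (d : ℕ) → .{{NonZero d}} → ℕ
negMod m d = d ∸ m % d

_-_² : ∀ {n} .{{_ : NonZero n}} → ℕ → Fin n → ℕ
_-_² {n} l x = l + negMod (toℕ x * toℕ x) n

module _ {d : ℕ} .{{_ : NonZero d}} where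

  [m%d+n]%d≡[m+n]%d : ∀ m n → (m % d + n) % d ≡ (m + n) % d
  [m%d+n]%d≡[m+n]%d m n = begin
    (m % d + n) % d           ≡⟨ %-distribˡ-+ (m % d) n d ⟩
    (m % d % d + n % d) % d   ≡⟨ cong (λ r → (r + n % d) % d) (m%n%n≡m%n m d) ⟩
    (m % d + n % d) % d       ≡⟨ %-distribˡ-+ m n d ⟨
    (m + n) % d               ∎
    where open ≡-Reasoning

  %-cong-+ʳ : ∀ {m n} o → m % d ≡ n % d → (m + o) % d ≡ (n + o) % d
  %-cong-+ʳ {m} {n} o m≡n = begin
    (m + o) % d       ≡⟨ [m%d+n]%d≡[m+n]%d m o ⟨
    (m % d + o) % d   ≡⟨ cong (λ r → (r + o) % d) m≡n ⟩
    (n % d + o) % d   ≡⟨ [m%d+n]%d≡[m+n]%d n o ⟩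
    (n + o) % d       ∎
    where open ≡-Reasoning

  d∣m+negMod : ∀ m → d ∣ m + negMod m d
  d∣m+negMod m = m%n≡0⇒n∣m _ d (begin
    (m + (d ∸ m % d)) % d       ≡⟨ [m%d+n]%d≡[m+n]%d m _ ⟨
    (m % d + (d ∸ m % d)) % d   ≡⟨ cong (_% d) (ℕₚ.m+[n∸m]≡n (m%n≤n m d)) ⟩
    d % d                       ≡⟨ n%n≡0 d ⟩
    0                           ∎)
    where open ≡-Reasoning

  [m+n]≡o⇒n≡[o-m] : ∀ m n o → (m + n) % d ≡ o % d → n % d ≡ (o + negMod m d) % d
  [m+n]≡o⇒n≡[o-m] m n o eq = begin
    n % d                      ≡⟨ %-remove-+ˡ n (d∣m+negMod m) ⟨
    (m + negMod m d + n) % d   ≡⟨ cong (_% d) (xy∙z≈xz∙y m (negMod m d) n) ⟩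
    (m + n + negMod m d) % d   ≡⟨ %-cong-+ʳ (negMod m d) eq ⟩
    (o + negMod m d) % d       ∎
    where open ≡-Reasoning

  n≡[o-m]⇒[m+n]≡o : ∀ m n o → n % d ≡ (o + negMod m d) % d → (m + n) % d ≡ o % d
  n≡[o-m]⇒[m+n]≡o m n o eq = begin
    (m + n) % d                ≡⟨ cong (_% d) (ℕₚ.+-comm m n) ⟩
    (n + m) % d                ≡⟨ %-cong-+ʳ m eq ⟩
    (o + negMod m d + m) % d   ≡⟨ cong (_% d) (xy∙z≈zy∙x o (negMod m d) m) ⟩
    (m + negMod m d + o) % d   ≡⟨ %-remove-+ˡ o (d∣m+negMod m) ⟩
    o % d                      ∎
    where open ≡-Reasoning

rho-suc : ∀ k l n .{{_ : NonZero n}} →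
  rho (suc k) l n ≡ sum (map (λ x → rho k (l - x ²) n) (allFin n))
rho-suc k l n = trans
  (length-filter-concatMap sumsTo-l (λ x → map (x Vec.∷_) (tuples n k)) (allFin n))
  (cong sum (map-cong count-first (allFin n)))
  where
  sumsTo-l : ∀ {m} → Decidable (λ (v : Vec (Fin n) m) → sumSq v % n ≡ l % n)
  sumsTo-l v = sumSq v % n ℕ.≟ l % n
  count-first : ∀ x → length (filter sumsTo-l (map (x Vec.∷_) (tuples n k))) ≡ rho k (l - x ²) n
  count-first x = trans (length-filter-map sumsTo-l (x Vec.∷_) (tuples n k))
    (cong length (filter-≐ _ _
      ( [m+n]≡o⇒n≡[o-m] (toℕ x * toℕ x) _ l
      , n≡[o-m]⇒[m+n]≡o (toℕ x * toℕ x) _ l)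
      (tuples n k)))

⊕-assoc : ∀ x y z → (x ⊕ y) ⊕ z ≡ x ⊕ (y ⊕ z)
⊕-assoc (q2 a b) (q2 c d) (q2 e f) = cong₂ q2 (ℚₚ.+-assoc a c e) (ℚₚ.+-assoc b d f)

⊕-comm : ∀ x y → x ⊕ y ≡ y ⊕ x
⊕-comm (q2 a b) (q2 c d) = cong₂ q2 (ℚₚ.+-comm a c) (ℚₚ.+-comm b d)

⊕-identityˡ : ∀ x → cst 0ℚ ⊕ x ≡ x
⊕-identityˡ (q2 a b) = cong₂ q2 (ℚₚ.+-identityˡ a) (ℚₚ.+-identityˡ b)

⊕-identityʳ : ∀ x → x ⊕ cst 0ℚ ≡ x
⊕-identityʳ (q2 a b) = cong₂ q2 (ℚₚ.+-identityʳ a) (ℚₚ.+-identityʳ b)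

neg-inverseˡ : ∀ x → neg x ⊕ x ≡ cst 0ℚ
neg-inverseˡ (q2 a b) = cong₂ q2 (ℚₚ.+-inverseˡ a) (ℚₚ.+-inverseˡ b)

neg-inverseʳ : ∀ x → x ⊕ neg x ≡ cst 0ℚ
neg-inverseʳ (q2 a b) = cong₂ q2 (ℚₚ.+-inverseʳ a) (ℚₚ.+-inverseʳ b)

module _ where
  open +-*-Solver using (solve; _:=_; _:+_; _:*_; con)

  private
    two : ℚ
    two = + 2 / 1

  ⊗-assoc : ∀ x y z → (x ⊗ y) ⊗ z ≡ x ⊗ (y ⊗ z)
  ⊗-assoc (q2 a b) (q2 c d) (q2 e f) = cong₂ q2
    (solve 6 (λ a b c d e f →
        (a :* c :+ con two :* (b :* d)) :* e :+ con two :* ((a :* d :+ b :* c) :* f)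
      := a :* (c :* e :+ con two :* (d :* f)) :+ con two :* (b :* (c :* f :+ d :* e)))
      refl a b c d e f)
    (solve 6 (λ a b c d e f →
        (a :* c :+ con two :* (b :* d)) :* f :+ (a :* d :+ b :* c) :* e
      := a :* (c :* f :+ d :* e) :+ b :* (c :* e :+ con two :* (d :* f)))
      refl a b c d e f)

  ⊗-comm : ∀ x y → x ⊗ y ≡ y ⊗ x
  ⊗-comm (q2 a b) (q2 c d) = cong₂ q2
    (solve 4 (λ a b c d → a :* c :+ con two :* (b :* d) := c :* a :+ con two :* (d :* b))
      refl a b c d)
    (solve 4 (λ a b c d → a :* d :+ b :* c := c :* b :+ d :* a) refl a b c d)

  ⊗-identityˡ : ∀ x → cst 1ℚ ⊗ x ≡ x
  ⊗-identityˡ (q2 a b) = cong₂ q2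
    (solve 2 (λ a b → con 1ℚ :* a :+ con two :* (con 0ℚ :* b) := a) refl a b)
    (solve 2 (λ a b → con 1ℚ :* b :+ con 0ℚ :* a := b) refl a b)

  ⊗-distribˡ-⊕ : ∀ x y z → x ⊗ (y ⊕ z) ≡ x ⊗ y ⊕ x ⊗ z
  ⊗-distribˡ-⊕ (q2 a b) (q2 c d) (q2 e f) = cong₂ q2
    (solve 6 (λ a b c d e f → a :* (c :+ e) :+ con two :* (b :* (d :+ f))
      := (a :* c :+ con two :* (b :* d)) :+ (a :* e :+ con two :* (b :* f)))
      refl a b c d e f)
    (solve 6 (λ a b c d e f → a :* (d :+ f) :+ b :* (c :+ e)
      := (a :* d :+ b :* c) :+ (a :* f :+ b :* e))
      refl a b c d e f)

⊗-identityʳ : ∀ x → x ⊗ cst 1ℚ ≡ x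
⊗-identityʳ x = trans (⊗-comm x (cst 1ℚ)) (⊗-identityˡ x)

⊗-distribʳ-⊕ : ∀ x y z → (y ⊕ z) ⊗ x ≡ y ⊗ x ⊕ z ⊗ x
⊗-distribʳ-⊕ x y z = begin
  (y ⊕ z) ⊗ x      ≡⟨ ⊗-comm (y ⊕ z) x ⟩
  x ⊗ (y ⊕ z)      ≡⟨ ⊗-distribˡ-⊕ x y z ⟩
  x ⊗ y ⊕ x ⊗ z    ≡⟨ cong₂ _⊕_ (⊗-comm x y) (⊗-comm x z) ⟩
  y ⊗ x ⊕ z ⊗ x    ∎
  where open ≡-Reasoning

_≟_ : DecidableEquality Q2
q2 a b ≟ q2 c d with a ℚₚ.≟ c | b ℚₚ.≟ d
... | yes refl | yes refl = yes refl
... | no a≢c   | _        = no λ { refl → a≢c refl }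
... | _        | no b≢d   = no λ { refl → b≢d refl }

Q2-isCommutativeRing : IsCommutativeRing _⊕_ _⊗_ neg (cst 0ℚ) (cst 1ℚ)
Q2-isCommutativeRing = record
  { isRing = record
    { +-isAbelianGroup = record
      { isGroup = record
        { isMonoid = record
          { isSemigroup = record
            { isMagma = record { isEquivalence = isEquivalence ; ∙-cong = cong₂ _⊕_ }
            ; assoc   = ⊕-assoc
            }
          ; identity = ⊕-identityˡ , ⊕-identityʳ
          }
        ; inverse = neg-inverseˡ , neg-inverseʳ
        ; ⁻¹-cong = cong neg
        }
      ; comm = ⊕-comm
      }
    ; *-cong     = cong₂ _⊗_
    ; *-assoc    = ⊗-assoc
    ; *-identity = ⊗-identityˡ , ⊗-identityʳ
    ; distrib    = ⊗-distribˡ-⊕ , ⊗-distribʳ-⊕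
    }
  ; *-comm = ⊗-comm
  }

Q2-commutativeRing : CommutativeRing _ _
Q2-commutativeRing = record { isCommutativeRing = Q2-isCommutativeRing }

module Q2-Solver = RingSolver (AlmostCommutativeRing.fromCommutativeRing Q2-commutativeRing) _≟_

nat-+ : ∀ m n → nat (m + n) ≡ nat m ⊕ nat n
nat-+ m n = cong₂ q2 (sym (begin
  + m / 1 ℚ.+ + n / 1                            ≡⟨ cong₂ ℚ._+_ (/1≡mkℚ m) (/1≡mkℚ n) ⟩
  mkℚ (+ m) 0 (1-coprime m) ℚ.+ mkℚ (+ n) 0 (1-coprime n)
    ≡⟨ cong (_/ 1) (cong₂ ℤ._+_ (ℤₚ.*-identityʳ (+ m)) (ℤₚ.*-identityʳ (+ n))) ⟩
  + (m + n) / 1                                ∎)) refl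
  where
  open ≡-Reasoning
  1-coprime : ∀ a → Coprime a 1
  1-coprime a = coprime-sym (1-coprimeTo a)
  /1≡mkℚ : ∀ a → + a / 1 ≡ mkℚ (+ a) 0 (1-coprime a)
  /1≡mkℚ a = ℚₚ.normalize-coprime (1-coprime a)

sumQ2 : List Q2 → Q2
sumQ2 = foldr _⊕_ (cst 0ℚ)

nat-sum-map : ∀ {a} {A : Set a} (g : A → ℕ) xs → nat (sum (map g xs)) ≡ sumQ2 (map (nat ∘ g) xs)
nat-sum-map g []       = refl
nat-sum-map g (x ∷ xs) = trans (nat-+ (g x) (sum (map g xs))) (cong (nat (g x) ⊕_) (nat-sum-map g xs))

pattern 8+_ m = suc (suc (suc (suc (suc (suc (suc (suc m)))))))

cosπ/4-suc : ∀ m → cosπ/4 (suc m) ≡ h√2 ⊗ (cosπ/4 m ⊖ sinπ/4 m)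
cosπ/4-suc 0 = refl
cosπ/4-suc 1 = refl
cosπ/4-suc 2 = refl
cosπ/4-suc 3 = refl
cosπ/4-suc 4 = refl
cosπ/4-suc 5 = refl
cosπ/4-suc 6 = refl
cosπ/4-suc 7 = refl
cosπ/4-suc (8+ m) = cosπ/4-suc m

sinπ/4-suc : ∀ m → sinπ/4 (suc m) ≡ h√2 ⊗ (sinπ/4 m ⊕ cosπ/4 m)
sinπ/4-suc 0 = refl
sinπ/4-suc 1 = refl
sinπ/4-suc 2 = refl
sinπ/4-suc 3 = refl
sinπ/4-suc 4 = refl
sinπ/4-suc 5 = refl
sinπ/4-suc 6 = refl
sinπ/4-suc 7 = refl
sinπ/4-suc (8+ m) = sinπ/4-suc m

cosπ/4-3+ : ∀ m → cosπ/4 (3 + m) ≡ neg (h√2 ⊗ (cosπ/4 m ⊕ sinπ/4 m))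
cosπ/4-3+ 0 = refl
cosπ/4-3+ 1 = refl
cosπ/4-3+ 2 = refl
cosπ/4-3+ 3 = refl
cosπ/4-3+ 4 = refl
cosπ/4-3+ 5 = refl
cosπ/4-3+ 6 = refl
cosπ/4-3+ 7 = refl
cosπ/4-3+ (8+ m) = cosπ/4-3+ m

sinπ/4-3+ : ∀ m → sinπ/4 (3 + m) ≡ h√2 ⊗ (cosπ/4 m ⊖ sinπ/4 m)
sinπ/4-3+ 0 = refl
sinπ/4-3+ 1 = refl
sinπ/4-3+ 2 = refl
sinπ/4-3+ 3 = refl
sinπ/4-3+ 4 = refl
sinπ/4-3+ 5 = refl
sinπ/4-3+ 6 = refl
sinπ/4-3+ 7 = refl
sinπ/4-3+ (8+ m) = sinπ/4-3+ m

record State (A : Set) : Set where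
  constructor state
  field
    √2ᵏ cosₖ sinₖ cos₃ₖ sin₃ₖ : A

-- The powers and trigonometric values at k occurring in the theorem: each formula below, read
-- in ℚ(√2) at atomsAt k, is literally the corresponding right-hand side of the statement.
record Atoms (A : Set) : Set where
  constructor atoms
  field
    2ᵏ 4ᵏ 8ᵏ 2²ᵏ √2ᵏ √2³ᵏ √2⁵ᵏ : A
    cosₖ sinₖ cos₃ₖ sin₃ₖ cosₖ₊₁ sinₖ₊₁ cos₃ₖ₊₁ sin₃ₖ₊₁ cos₃₍ₖ₊₁₎ : A

-- Written over an arbitrary raw ring so that the same text yields both the values in ℚ(√2)
-- (module Q) and the polynomials handed to the ring solver (module P).
module ClosedForms {ℓ} (R : RawRing 0ℓ ℓ) (κ : Q2 → RawRing.Carrier R) where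
  open RawRing R using (Carrier; 0#; rawSemiring)
    renaming (_+_ to infixl 6 _+ᴿ_; _*_ to infixl 7 _*ᴿ_; -_ to infix 8 -ᴿ_)
  open import Algebra.Definitions.RawSemiring rawSemiring using () renaming (_^_ to _^ᴿ_)
  open Atoms

  infixl 6 _-ᴿ_
  _-ᴿ_ : Carrier → Carrier → Carrier
  x -ᴿ y = x +ᴿ -ᴿ y

  Σ : List Carrier → Carrier
  Σ = foldr _+ᴿ_ 0#

  cos+π/4 sin+π/4 cos+3π/4 sin+3π/4 : Carrier → Carrier → Carrier
  cos+π/4  c s = κ h√2 *ᴿ (c -ᴿ s)
  sin+π/4  c s = κ h√2 *ᴿ (s +ᴿ c)
  cos+3π/4 c s = -ᴿ (κ h√2 *ᴿ (c +ᴿ s))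
  sin+3π/4 c s = κ h√2 *ᴿ (c -ᴿ s)

  advance : State Carrier → State Carrier
  advance (state y c s c₃ s₃) =
    state (κ √2 *ᴿ y) (cos+π/4 c s) (sin+π/4 c s) (cos+3π/4 c₃ s₃) (sin+3π/4 c₃ s₃)

  atomsOf : State Carrier → Atoms Carrier
  atomsOf (state y c s c₃ s₃) =
    atoms (y ^ᴿ 2) (y ^ᴿ 4) (y ^ᴿ 6) (y ^ᴿ 4) y (y ^ᴿ 3) (y ^ᴿ 5) c s c₃ s₃
          (cos+π/4 c s) (sin+π/4 c s) (cos+π/4 c₃ s₃) (sin+π/4 c₃ s₃) (cos+3π/4 c₃ s₃)

  advanced : (ℕ → Atoms Carrier → Carrier) → ℕ → State Carrier → Carrier
  advanced f l s = f l (atomsOf (advance s))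

  recurrence : (n : ℕ) .{{_ : NonZero n}} → (ℕ → Atoms Carrier → Carrier) → ℕ → State Carrier → Carrier
  recurrence n f l s = Σ (map (λ x → f (l - x ²) (atomsOf s)) (allFin n))

  ½ ¼ ⅛ two : Carrier
  ½ = κ (cst (+ 1 / 2))
  ¼ = κ (cst (+ 1 / 4))
  ⅛ = κ (cst (+ 1 / 8))
  two = κ (nat 2)

  formula₂ : ℕ → Atoms Carrier → Carrier
  formula₂ _ a = ½ *ᴿ 2ᵏ a

  formula₄ : ℕ → Atoms Carrier → Carrier
  formula₄ 0 a = ¼ *ᴿ 4ᵏ a +ᴿ ½ *ᴿ √2³ᵏ a *ᴿ cosₖ a
  formula₄ 1 a = ¼ *ᴿ 4ᵏ a +ᴿ ½ *ᴿ √2³ᵏ a *ᴿ sinₖ a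
  formula₄ 2 a = ¼ *ᴿ 4ᵏ a -ᴿ ½ *ᴿ √2³ᵏ a *ᴿ cosₖ a
  formula₄ 3 a = ¼ *ᴿ 4ᵏ a -ᴿ ½ *ᴿ √2³ᵏ a *ᴿ sinₖ a
  formula₄ (suc (suc (suc (suc l)))) a = formula₄ l a

  formula₈ : ℕ → Atoms Carrier → Carrier
  formula₈ 0 a = ⅛ *ᴿ 8ᵏ a +ᴿ ¼ *ᴿ 2²ᵏ a *ᴿ cosₖ a +ᴿ ¼ *ᴿ √2⁵ᵏ a *ᴿ cosₖ a +ᴿ ¼ *ᴿ 2²ᵏ a *ᴿ cos₃ₖ a
  formula₈ 1 a = ⅛ *ᴿ 2²ᵏ a *ᴿ
    (2ᵏ a +ᴿ √2ᵏ a *ᴿ two *ᴿ sinₖ a +ᴿ two *ᴿ sinₖ₊₁ a -ᴿ two *ᴿ cos₃ₖ₊₁ a)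
  formula₈ 2 a = ⅛ *ᴿ 8ᵏ a -ᴿ ¼ *ᴿ √2⁵ᵏ a *ᴿ cosₖ a +ᴿ ¼ *ᴿ 2²ᵏ a *ᴿ sinₖ a -ᴿ ¼ *ᴿ 2²ᵏ a *ᴿ sin₃ₖ a
  formula₈ 3 a = ⅛ *ᴿ 2²ᵏ a *ᴿ
    (2ᵏ a -ᴿ √2ᵏ a *ᴿ two *ᴿ sinₖ a -ᴿ two *ᴿ (cosₖ₊₁ a +ᴿ cos₃₍ₖ₊₁₎ a))
  formula₈ 4 a = ⅛ *ᴿ 8ᵏ a -ᴿ ¼ *ᴿ 2²ᵏ a *ᴿ cosₖ a +ᴿ ¼ *ᴿ √2⁵ᵏ a *ᴿ cosₖ a -ᴿ ¼ *ᴿ 2²ᵏ a *ᴿ cos₃ₖ a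
  formula₈ 5 a = ⅛ *ᴿ 2²ᵏ a *ᴿ
    (2ᵏ a +ᴿ √2ᵏ a *ᴿ two *ᴿ sinₖ a -ᴿ two *ᴿ sinₖ₊₁ a +ᴿ two *ᴿ cos₃ₖ₊₁ a)
  formula₈ 6 a = ⅛ *ᴿ 8ᵏ a -ᴿ ¼ *ᴿ √2⁵ᵏ a *ᴿ cosₖ a -ᴿ ¼ *ᴿ 2²ᵏ a *ᴿ sinₖ a +ᴿ ¼ *ᴿ 2²ᵏ a *ᴿ sin₃ₖ a
  formula₈ 7 a = ⅛ *ᴿ 2²ᵏ a *ᴿ
    (2ᵏ a -ᴿ √2ᵏ a *ᴿ two *ᴿ sinₖ a -ᴿ two *ᴿ sin₃ₖ₊₁ a +ᴿ two *ᴿ cosₖ₊₁ a)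
  formula₈ (8+ l) a = formula₈ l a

open import Algebra.Properties.Semiring.Exp (CommutativeRing.semiring Q2-commutativeRing)
  using () renaming (_^_ to _^ᴿ_; ^-assocʳ to ^ᴿ-assocʳ)

^≡^ᴿ : ∀ x n → x ^ n ≡ x ^ᴿ n
^≡^ᴿ x zero    = refl
^≡^ᴿ x (suc n) = cong (x ⊗_) (^≡^ᴿ x n)

^-*ˡ : ∀ x m n → x ^ (m * n) ≡ (x ^ n) ^ᴿ m
^-*ˡ x m n = begin
  x ^ (m * n)     ≡⟨ ^≡^ᴿ x (m * n) ⟩
  x ^ᴿ (m * n)    ≡⟨ cong (x ^ᴿ_) (ℕₚ.*-comm m n) ⟩
  x ^ᴿ (n * m)    ≡⟨ ^ᴿ-assocʳ x n m ⟨
  (x ^ᴿ n) ^ᴿ m     ≡⟨ cong (_^ᴿ m) (^≡^ᴿ x n) ⟨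
  (x ^ n) ^ᴿ m      ∎
  where open ≡-Reasoning

^-swap : ∀ x m n → (x ^ᴿ m) ^ n ≡ (x ^ n) ^ᴿ m
^-swap x m n = begin
  (x ^ᴿ m) ^ n      ≡⟨ ^≡^ᴿ (x ^ᴿ m) n ⟩
  (x ^ᴿ m) ^ᴿ n     ≡⟨ ^ᴿ-assocʳ x m n ⟩
  x ^ᴿ (m * n)    ≡⟨ ^≡^ᴿ x (m * n) ⟨
  x ^ (m * n)     ≡⟨ ^-*ˡ x m n ⟩
  (x ^ n) ^ᴿ m      ∎
  where open ≡-Reasoning

module Q = ClosedForms (CommutativeRing.rawRing Q2-commutativeRing) (λ x → x)

stateAt : ℕ → State Q2
stateAt k = state (√2 ^ k) (cosπ/4 k) (sinπ/4 k) (cosπ/4 (3 * k)) (sinπ/4 (3 * k))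

atomsAt : ℕ → Atoms Q2
atomsAt k = atoms (nat 2 ^ k) (nat 4 ^ k) (nat 8 ^ k) (nat 2 ^ (2 * k))
  (√2 ^ k) (√2 ^ (3 * k)) (√2 ^ (5 * k))
  (cosπ/4 k) (sinπ/4 k) (cosπ/4 (3 * k)) (sinπ/4 (3 * k))
  (cosπ/4 (k + 1)) (sinπ/4 (k + 1)) (cosπ/4 (3 * k + 1)) (sinπ/4 (3 * k + 1))
  (cosπ/4 (3 * (k + 1)))

3*[k+1]≡3+3*k : ∀ k → 3 * (k + 1) ≡ 3 + 3 * k
3*[k+1]≡3+3*k k = trans (cong (3 *_) (ℕₚ.+-comm k 1)) (ℕₚ.*-suc 3 k)

stateAt-suc : ∀ k → stateAt (suc k) ≡ Q.advance (stateAt k)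
stateAt-suc k = cong₂ (λ (c , s) (c₃ , s₃) → state (√2 ^ suc k) c s c₃ s₃)
  (cong₂ _,_ (cosπ/4-suc k) (sinπ/4-suc k))
  (cong₂ _,_ (trans (cong cosπ/4 (ℕₚ.*-suc 3 k)) (cosπ/4-3+ (3 * k)))
             (trans (cong sinπ/4 (ℕₚ.*-suc 3 k)) (sinπ/4-3+ (3 * k))))

cosπ/4-+1 : ∀ m → cosπ/4 (m + 1) ≡ h√2 ⊗ (cosπ/4 m ⊖ sinπ/4 m)
cosπ/4-+1 m = trans (cong cosπ/4 (ℕₚ.+-comm m 1)) (cosπ/4-suc m)

sinπ/4-+1 : ∀ m → sinπ/4 (m + 1) ≡ h√2 ⊗ (sinπ/4 m ⊕ cosπ/4 m)
sinπ/4-+1 m = trans (cong sinπ/4 (ℕₚ.+-comm m 1)) (sinπ/4-suc m)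

atomsAt≡atomsOf-stateAt : ∀ k → atomsAt k ≡ Q.atomsOf (stateAt k)
atomsAt≡atomsOf-stateAt k =
  refl {x = atoms} ⊛ ^-swap √2 2 k ⊛ ^-swap √2 4 k ⊛ ^-swap √2 6 k ⊛ 2²ᵏ≡ ⊛ refl
       ⊛ ^-*ˡ √2 3 k ⊛ ^-*ˡ √2 5 k ⊛ refl ⊛ refl ⊛ refl ⊛ refl
       ⊛ cosπ/4-+1 k ⊛ sinπ/4-+1 k ⊛ cosπ/4-+1 (3 * k) ⊛ sinπ/4-+1 (3 * k)
       ⊛ trans (cong cosπ/4 (3*[k+1]≡3+3*k k)) (cosπ/4-3+ (3 * k))
  where
  infixl 0 _⊛_
  _⊛_ : ∀ {A B : Set} {f g : A → B} {x y} → f ≡ g → x ≡ y → f x ≡ g y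
  _⊛_ = cong₂ (λ f x → f x)
  2²ᵏ≡ : nat 2 ^ (2 * k) ≡ (√2 ^ k) ^ᴿ 4
  2²ᵏ≡ = trans (^-swap √2 2 (2 * k))
               (trans (cong (_^ᴿ 2) (^-*ˡ √2 2 k)) (^ᴿ-assocʳ (√2 ^ k) 2 2))

module _ (n : ℕ) .{{_ : NonZero n}} (f : ℕ → Atoms Q2 → Q2)
         (f-base : ∀ l → nat (rho 1 l n) ≡ f l (atomsAt 1))
         (f-advance : ∀ l s → Q.advanced f l s ≡ Q.recurrence n f l s) where

  rho≡formula : ∀ k l → nat (rho (suc k) l n) ≡ f l (atomsAt (suc k))
  rho≡formula zero    l = f-base l
  rho≡formula (suc k) l = begin
    nat (rho (2 + k) l n)                                   ≡⟨ cong nat (rho-suc (suc k) l n) ⟩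
    nat (sum (map (λ x → rho (suc k) (l - x ²) n) (allFin n)))  ≡⟨ nat-sum-map _ (allFin n) ⟩
    sumQ2 (map (λ x → nat (rho (suc k) (l - x ²) n)) (allFin n))
      ≡⟨ cong sumQ2 (map-cong (λ x → rho≡formula k (l - x ²)) (allFin n)) ⟩
    sumQ2 (map (λ x → f (l - x ²) (atomsAt (suc k))) (allFin n))
      ≡⟨ cong (λ a → sumQ2 (map (λ x → f (l - x ²) a) (allFin n))) (atomsAt≡atomsOf-stateAt (suc k)) ⟩
    Q.recurrence n f l (stateAt (suc k))                    ≡⟨ f-advance l (stateAt (suc k)) ⟨
    Q.advanced f l (stateAt (suc k))                        ≡⟨ cong (f l ∘ Q.atomsOf) (stateAt-suc (suc k)) ⟨
    f l (Q.atomsOf (stateAt (2 + k)))                       ≡⟨ cong (f l) (atomsAt≡atomsOf-stateAt (2 + k)) ⟨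
    f l (atomsAt (2 + k))                                   ∎
    where open ≡-Reasoning

open Q2-Solver using (Polynomial; _:+_; _:*_; :-_; con; var; ⟦_⟧; ⟦_⟧↓; prove)

polynomialRawRing : RawRing 0ℓ 0ℓ
polynomialRawRing = record
  { Carrier = Polynomial 5
  ; _≈_     = _≡_
  ; _+_     = _:+_
  ; _*_     = _:*_
  ; -_      = :-_
  ; 0#      = con (cst 0ℚ)
  ; 1#      = con (cst 1ℚ)
  }

module P = ClosedForms polynomialRawRing con

variables : State (Polynomial 5)
variables = state (var (# 0)) (var (# 1)) (var (# 2)) (var (# 3)) (var (# 4))

environment : State Q2 → Vec Q2 5
environment (state y c s c₃ s₃) = y Vec.∷ c Vec.∷ s Vec.∷ c₃ Vec.∷ s₃ Vec.∷ Vec.[]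

module _ (n : ℕ) .{{_ : NonZero n}} (f : ℕ → Atoms (Polynomial 5) → Polynomial 5) (l : ℕ) (s : State Q2) where

  advance-by-ring : ⟦ P.advanced f l variables ⟧↓ (environment s) ≡ ⟦ P.recurrence n f l variables ⟧↓ (environment s) →
                    ⟦ P.advanced f l variables ⟧ (environment s) ≡ ⟦ P.recurrence n f l variables ⟧ (environment s)
  advance-by-ring = prove (environment s) (P.advanced f l variables) (P.recurrence n f l variables)

formula₂-advance : ∀ l s → Q.advanced Q.formula₂ l s ≡ Q.recurrence 2 Q.formula₂ l s
formula₂-advance l s = advance-by-ring 2 P.formula₂ l s refl

formula₄-advance : ∀ l s → Q.advanced Q.formula₄ l s ≡ Q.recurrence 4 Q.formula₄ l s
formula₄-advance 0 s = advance-by-ring 4 P.formula₄ 0 s refl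
formula₄-advance 1 s = advance-by-ring 4 P.formula₄ 1 s refl
formula₄-advance 2 s = advance-by-ring 4 P.formula₄ 2 s refl
formula₄-advance 3 s = advance-by-ring 4 P.formula₄ 3 s refl
formula₄-advance (suc (suc (suc (suc l)))) s = formula₄-advance l s

formula₈-advance : ∀ l s → Q.advanced Q.formula₈ l s ≡ Q.recurrence 8 Q.formula₈ l s
formula₈-advance 0 s = advance-by-ring 8 P.formula₈ 0 s refl
formula₈-advance 1 s = advance-by-ring 8 P.formula₈ 1 s refl
formula₈-advance 2 s = advance-by-ring 8 P.formula₈ 2 s refl
formula₈-advance 3 s = advance-by-ring 8 P.formula₈ 3 s refl
formula₈-advance 4 s = advance-by-ring 8 P.formula₈ 4 s refl
formula₈-advance 5 s = advance-by-ring 8 P.formula₈ 5 s refl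
formula₈-advance 6 s = advance-by-ring 8 P.formula₈ 6 s refl
formula₈-advance 7 s = advance-by-ring 8 P.formula₈ 7 s refl
formula₈-advance (8+ l) s = formula₈-advance l s

formula₂-base : ∀ l → nat (rho 1 l 2) ≡ Q.formula₂ l (atomsAt 1)
formula₂-base 0 = refl
formula₂-base 1 = refl
formula₂-base (suc (suc l)) = formula₂-base l

formula₄-base : ∀ l → nat (rho 1 l 4) ≡ Q.formula₄ l (atomsAt 1)
formula₄-base 0 = refl
formula₄-base 1 = refl
formula₄-base 2 = refl
formula₄-base 3 = refl
formula₄-base (suc (suc (suc (suc l)))) = formula₄-base l

formula₈-base : ∀ l → nat (rho 1 l 8) ≡ Q.formula₈ l (atomsAt 1)
formula₈-base 0 = refl
formula₈-base 1 = refl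
formula₈-base 2 = refl
formula₈-base 3 = refl
formula₈-base 4 = refl
formula₈-base 5 = refl
formula₈-base 6 = refl
formula₈-base 7 = refl
formula₈-base (8+ l) = formula₈-base l

proposition2 : (k : ℕ) → 1 ≤ k →
    (nat (rho k 1 2) ≡ cst (+ 1 / 2) ⊗ nat 2 ^ k
      × nat (rho k 0 2) ≡ cst (+ 1 / 2) ⊗ nat 2 ^ k)
  × nat (rho k 0 4) ≡ cst (+ 1 / 4) ⊗ nat 4 ^ k ⊕ cst (+ 1 / 2) ⊗ √2 ^ (3 * k) ⊗ cosπ/4 k
  × nat (rho k 1 4) ≡ cst (+ 1 / 4) ⊗ nat 4 ^ k ⊕ cst (+ 1 / 2) ⊗ √2 ^ (3 * k) ⊗ sinπ/4 k
  × nat (rho k 2 4) ≡ cst (+ 1 / 4) ⊗ nat 4 ^ k ⊖ cst (+ 1 / 2) ⊗ √2 ^ (3 * k) ⊗ cosπ/4 k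
  × nat (rho k 3 4) ≡ cst (+ 1 / 4) ⊗ nat 4 ^ k ⊖ cst (+ 1 / 2) ⊗ √2 ^ (3 * k) ⊗ sinπ/4 k
  × nat (rho k 0 8) ≡ cst (+ 1 / 8) ⊗ nat 8 ^ k
                      ⊕ cst (+ 1 / 4) ⊗ nat 2 ^ (2 * k) ⊗ cosπ/4 k
                      ⊕ cst (+ 1 / 4) ⊗ √2 ^ (5 * k) ⊗ cosπ/4 k
                      ⊕ cst (+ 1 / 4) ⊗ nat 2 ^ (2 * k) ⊗ cosπ/4 (3 * k)
  × nat (rho k 1 8) ≡ cst (+ 1 / 8) ⊗ nat 2 ^ (2 * k) ⊗
                      (nat 2 ^ k ⊕ √2 ^ k ⊗ nat 2 ⊗ sinπ/4 k
                       ⊕ nat 2 ⊗ sinπ/4 (k + 1) ⊖ nat 2 ⊗ cosπ/4 (3 * k + 1))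
  × nat (rho k 2 8) ≡ cst (+ 1 / 8) ⊗ nat 8 ^ k
                      ⊖ cst (+ 1 / 4) ⊗ √2 ^ (5 * k) ⊗ cosπ/4 k
                      ⊕ cst (+ 1 / 4) ⊗ nat 2 ^ (2 * k) ⊗ sinπ/4 k
                      ⊖ cst (+ 1 / 4) ⊗ nat 2 ^ (2 * k) ⊗ sinπ/4 (3 * k)
  × nat (rho k 3 8) ≡ cst (+ 1 / 8) ⊗ nat 2 ^ (2 * k) ⊗
                      (nat 2 ^ k ⊖ √2 ^ k ⊗ nat 2 ⊗ sinπ/4 k
                       ⊖ nat 2 ⊗ (cosπ/4 (k + 1) ⊕ cosπ/4 (3 * (k + 1))))
  × nat (rho k 4 8) ≡ cst (+ 1 / 8) ⊗ nat 8 ^ k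
                      ⊖ cst (+ 1 / 4) ⊗ nat 2 ^ (2 * k) ⊗ cosπ/4 k
                      ⊕ cst (+ 1 / 4) ⊗ √2 ^ (5 * k) ⊗ cosπ/4 k
                      ⊖ cst (+ 1 / 4) ⊗ nat 2 ^ (2 * k) ⊗ cosπ/4 (3 * k)
  × nat (rho k 5 8) ≡ cst (+ 1 / 8) ⊗ nat 2 ^ (2 * k) ⊗
                      (nat 2 ^ k ⊕ √2 ^ k ⊗ nat 2 ⊗ sinπ/4 k
                       ⊖ nat 2 ⊗ sinπ/4 (k + 1) ⊕ nat 2 ⊗ cosπ/4 (3 * k + 1))
  × nat (rho k 6 8) ≡ cst (+ 1 / 8) ⊗ nat 8 ^ k
                      ⊖ cst (+ 1 / 4) ⊗ √2 ^ (5 * k) ⊗ cosπ/4 k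
                      ⊖ cst (+ 1 / 4) ⊗ nat 2 ^ (2 * k) ⊗ sinπ/4 k
                      ⊕ cst (+ 1 / 4) ⊗ nat 2 ^ (2 * k) ⊗ sinπ/4 (3 * k)
  × nat (rho k 7 8) ≡ cst (+ 1 / 8) ⊗ nat 2 ^ (2 * k) ⊗
                      (nat 2 ^ k ⊖ √2 ^ k ⊗ nat 2 ⊗ sinπ/4 k
                       ⊖ nat 2 ⊗ sinπ/4 (3 * k + 1) ⊕ nat 2 ⊗ cosπ/4 (k + 1))
proposition2 zero ()
proposition2 (suc k) _ =
    (mod₂ 1 , mod₂ 0)
  , mod₄ 0 , mod₄ 1 , mod₄ 2 , mod₄ 3
  , mod₈ 0 , mod₈ 1 , mod₈ 2 , mod₈ 3 , mod₈ 4 , mod₈ 5 , mod₈ 6 , mod₈ 7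
  where
  mod₂ : ∀ l → nat (rho (suc k) l 2) ≡ Q.formula₂ l (atomsAt (suc k))
  mod₂ = rho≡formula 2 Q.formula₂ formula₂-base formula₂-advance k
  mod₄ : ∀ l → nat (rho (suc k) l 4) ≡ Q.formula₄ l (atomsAt (suc k))
  mod₄ = rho≡formula 4 Q.formula₄ formula₄-base formula₄-advance k
  mod₈ : ∀ l → nat (rho (suc k) l 8) ≡ Q.formula₈ l (atomsAt (suc k))
  mod₈ = rho≡formula 8 Q.formula₈ formula₈-base formula₈-advance k
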